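{- Let $C$ be a negacyclic conference matrix of order $n\equiv0\pmod4$ with first row $c=(0,c_1,c_2,\dots,c_{n-1})$. Then the sequences $a=(1,c_2,c_4,\dots,c_{n-2})$ and $b=(c_1,c_3,\dots,c_{n-1})$ form a negaperiodic Golay pair of length $v=n/2$.
   Context: A conference matrix of order $n$ is an $n\times n$ matrix $C$ with zero diagonal, off-diagonal entries $\pm1$, and $CC^T=(n-1)I$. A negacyclic matrix of order $n$ is a polynomial in the negacyclic shift matrix $N$ ($N_{i,i+1}=1$ for $0\le i\le n-2$, $N_{n-1,0}=-1$, other entries $0$). For a sequence $a$ of length $v$, $\mathrm{NAF}_a(k)=a\cdot aN^k$ with $N$ the $v\times v$ negacyclic shift matrix; a negaperiodic Golay pair of length $v$ is a pair $(a,b)$ of $\{\pm1\}$-sequences of length $v$ with $\mathrm{NAF}_a(k)+\mathrm{NAF}_b(k)=0$ for $0<k<v$. -}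

module Defs where

open import Data.Nat as ℕ using (ℕ; zero; suc; _∸_; _<?_)
open import Data.Fin using (Fin; toℕ) renaming (zero to fz; suc to fs)
open import Data.Integer using (ℤ; +_; -_; _+_; _*_; 0ℤ; 1ℤ)
open import Data.List using (List; []; _∷_)
open import Data.Product using (Σ; _×_; _,_)
open import Data.Sum using (_⊎_)
open import Relation.Binary.PropositionalEquality using (_≡_)
open import Relation.Nullary using (yes; no)
open import Relation.Nullary.Decidable using (⌊_⌋)
open import Data.Bool using (if_then_else_; _∧_)

Matrix : ℕ → Set
Matrix n = Fin n → Fin n → ℤ

Seq : ℕ → Set
Seq v = Fin v → ℤ

sumFin : (n : ℕ) → (Fin n → ℤ) → ℤ
sumFin zero    f = 0ℤ
sumFin (suc n) f = f fz + sumFin n (λ i → f (fs i))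

idM : (n : ℕ) → Matrix n
idM n i j = if ⌊ toℕ i ℕ.≟ toℕ j ⌋ then 1ℤ else 0ℤ

zeroM : (n : ℕ) → Matrix n
zeroM n i j = 0ℤ

_⊕_ : {n : ℕ} → Matrix n → Matrix n → Matrix n
(A ⊕ B) i j = A i j + B i j

_·M_ : {n : ℕ} → ℤ → Matrix n → Matrix n
(x ·M A) i j = x * A i j

_⊗_ : {n : ℕ} → Matrix n → Matrix n → Matrix n
_⊗_ {n} A B i j = sumFin n (λ k → A i k * B k j)

transpose : {n : ℕ} → Matrix n → Matrix n
transpose A i j = A j i

_^M_ : {n : ℕ} → Matrix n → ℕ → Matrix n
_^M_ {n} A zero    = idM n
_^M_ {n} A (suc k) = (A ^M k) ⊗ A

negaShift : (n : ℕ) → Matrix n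
negaShift n i j =
  if ⌊ toℕ j ℕ.≟ suc (toℕ i) ⌋ then 1ℤ
  else if ⌊ toℕ i ℕ.≟ n ∸ 1 ⌋ ∧ ⌊ toℕ j ℕ.≟ 0 ⌋ then - 1ℤ
  else 0ℤ

polyEval : {n : ℕ} → List ℤ → Matrix n → Matrix n
polyEval {n} []       A = zeroM n
polyEval {n} (p ∷ ps) A = (p ·M idM n) ⊕ (polyEval ps A ⊗ A)

IsNegacyclic : {n : ℕ} → Matrix n → Set
IsNegacyclic {n} C = Σ (List ℤ) λ p → ∀ i j → C i j ≡ polyEval p (negaShift n) i j

IsPM1 : ℤ → Set
IsPM1 x = (x ≡ 1ℤ) ⊎ (x ≡ - 1ℤ)

IsConference : {n : ℕ} → Matrix n → Set
IsConference {n} C =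
  (∀ i → C i i ≡ 0ℤ) ×
  (∀ i j → ¬≡ i j → IsPM1 (C i j)) ×
  (∀ i j → (C ⊗ transpose C) i j ≡ ((+ (n ∸ 1)) ·M idM n) i j)
  where
  ¬≡ : Fin n → Fin n → Set
  ¬≡ i j = i ≡ j → Data.Empty.⊥
    where import Data.Empty

vecMat : {v : ℕ} → Seq v → Matrix v → Seq v
vecMat {v} a M j = sumFin v (λ i → a i * M i j)

dot : {v : ℕ} → Seq v → Seq v → ℤ
dot {v} a b = sumFin v (λ i → a i * b i)

NAF : {v : ℕ} → Seq v → ℕ → ℤ
NAF {v} a k = dot a (vecMat a (negaShift v ^M k))

IsNegaperiodicGolayPair : {v : ℕ} → Seq v → Seq v → Set
IsNegaperiodicGolayPair {v} a b =
  (∀ i → IsPM1 (a i)) × (∀ i → IsPM1 (b i)) ×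
  (∀ k → 0 ℕ.< k → k ℕ.< v → NAF a k + NAF b k ≡ 0ℤ)

-- First row of C as an ℕ-indexed sequence c_j (0 outside 0 ≤ j < n; only
-- indices j < n are ever used below).
firstRow : {n : ℕ} → Matrix n → ℕ → ℤ
firstRow {zero}  C j = 0ℤ
firstRow {suc n} C j with j <? suc n
... | yes j<n = C fz (Data.Fin.fromℕ< j<n)
... | no  _   = 0ℤ

seqA : {n : ℕ} → Matrix n → (v : ℕ) → Seq v
seqA C v i with toℕ i
... | zero  = 1ℤ
... | suc m = firstRow C (2 ℕ.* suc m)

seqB : {n : ℕ} → Matrix n → (v : ℕ) → Seq v
seqB C v i = firstRow C (suc (2 ℕ.* toℕ i))

module Submission where

-- As N^k has first row e_k,
--    NAF becomes the explicit autocorrelation `autocorr v x k`;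
--  * counting mod 4: for three distinct rows p, q, r of a ±1 array with
--    orthogonal rows, Σ_m (L_pm + L_qm)(L_pm + L_rm) = n - 1, and every term
--    outside the columns p, q, r is a multiple of 4;
--  * splitting an autocorrelation into even and odd subsequences, and the effect
--    of changing the first entry of a sequence;
--  * for a negacyclic conference matrix C with first row c: orthogonality of rows
--    0 and s gives autocorr n c s = 0, and the count on rows/columns 0, k, 2k
--    with n ≡ 0 (mod 4) gives the symmetry c_{2k} = c_{n-2k}.
-- The theorem follows: NAF_a(k) + NAF_b(k) equals the autocorrelations of the
-- even and odd parts of c plus c_{2k} - c_{n-2k} = 0, i.e. autocorr n c (2k) = 0.

open import Defs
open import Data.Nat using (ℕ; _/_; _%_)
open import Relation.Binary.PropositionalEquality using (_≡_)

open import Data.Nat as ℕ using (zero; suc; _∸_; _<_; _≤_; _<?_; _≤?_; s≤s; z≤n; z<s; s<s)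
import Data.Nat.Properties as ℕP
import Data.Nat.Divisibility as ℕD
open import Data.Nat.DivMod using (m*[n/m]≡n)
open import Data.Fin using (Fin; toℕ; fromℕ<) renaming (zero to fz; suc to fs)
open import Data.Fin.Properties using (fromℕ<-toℕ; toℕ<n; toℕ-fromℕ<)
open import Data.Integer using (ℤ; +_; -_; _+_; _*_; _-_; 0ℤ; 1ℤ)
import Data.Integer.Properties as ℤP
open import Data.Integer.Divisibility.Signed
  using (_∣_; divides; _∣?_; ∣m∣n⇒∣m+n; ∣m∣n⇒∣m-n; ∣ᵤ⇒∣)
open import Data.Integer.Tactic.RingSolver using (solve-∀)
open import Data.Product using (_,_; proj₁; proj₂)
open import Data.Sum using (inj₁; inj₂)
open import Data.Empty using (⊥-elim)
open import Data.List using (List; []; _∷_)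
open import Function using (_∘_)
open import Relation.Binary.PropositionalEquality
  using (_≢_; refl; sym; trans; cong; cong₂; subst; subst₂; module ≡-Reasoning)
open import Relation.Nullary using (Dec; yes; no; ¬_; contradiction)
open import Data.Bool using (if_then_else_)
open import Relation.Nullary.Decidable using (⌊_⌋; True; False; toWitness; toWitnessFalse)

open ≡-Reasoning

sumℕ : ℕ → (ℕ → ℤ) → ℤ
sumℕ zero    F = 0ℤ
sumℕ (suc n) F = F 0 + sumℕ n (λ m → F (suc m))

sumFin≡sumℕ : ∀ n (f : Fin n → ℤ) (F : ℕ → ℤ) → (∀ i → f i ≡ F (toℕ i)) →
  sumFin n f ≡ sumℕ n F
sumFin≡sumℕ zero    f F f≡F = refl
sumFin≡sumℕ (suc n) f F f≡F =
  cong₂ _+_ (f≡F fz) (sumFin≡sumℕ n (f ∘ fs) (F ∘ suc) (f≡F ∘ fs))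

sumℕ-cong : ∀ n {F G : ℕ → ℤ} → (∀ m → m < n → F m ≡ G m) → sumℕ n F ≡ sumℕ n G
sumℕ-cong zero    F≡G = refl
sumℕ-cong (suc n) F≡G =
  cong₂ _+_ (F≡G 0 z<s) (sumℕ-cong n (λ m m<n → F≡G (suc m) (s<s m<n)))

sumℕ-+ : ∀ n (F G : ℕ → ℤ) → sumℕ n (λ m → F m + G m) ≡ sumℕ n F + sumℕ n G
sumℕ-+ zero    F G = refl
sumℕ-+ (suc n) F G =
  trans (cong (λ s → (F 0 + G 0) + s) (sumℕ-+ n (F ∘ suc) (G ∘ suc))) (interchange (F 0) (G 0) _ _)
  where
  interchange : ∀ a b c d → (a + b) + (c + d) ≡ (a + c) + (b + d)
  interchange = solve-∀

sumℕ-neg : ∀ n (F : ℕ → ℤ) → sumℕ n (λ m → - F m) ≡ - sumℕ n F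
sumℕ-neg zero    F = refl
sumℕ-neg (suc n) F =
  trans (cong (λ s → - F 0 + s) (sumℕ-neg n (F ∘ suc))) (sym (ℤP.neg-distrib-+ (F 0) _))

sumℕ-bilinear : ∀ n (a b c d : ℕ → ℤ) →
  sumℕ n (λ m → (a m + b m) * (c m + d m)) ≡
  sumℕ n (λ m → a m * c m) + sumℕ n (λ m → a m * d m) +
  sumℕ n (λ m → b m * c m) + sumℕ n (λ m → b m * d m)
sumℕ-bilinear n a b c d = begin
    sumℕ n (λ m → (a m + b m) * (c m + d m))
  ≡⟨ sumℕ-cong n (λ m _ → expand (a m) (b m) (c m) (d m)) ⟩
    sumℕ n (λ m → a m * c m + a m * d m + b m * c m + b m * d m)
  ≡⟨ sumℕ-+ n _ _ ⟩
    sumℕ n (λ m → a m * c m + a m * d m + b m * c m) + sumℕ n (λ m → b m * d m)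
  ≡⟨ cong (_+ _) (trans (sumℕ-+ n _ _) (cong (_+ _) (sumℕ-+ n _ _))) ⟩
    sumℕ n (λ m → a m * c m) + sumℕ n (λ m → a m * d m) +
    sumℕ n (λ m → b m * c m) + sumℕ n (λ m → b m * d m) ∎
  where
  expand : ∀ a b c d → (a + b) * (c + d) ≡ a * c + a * d + b * c + b * d
  expand = solve-∀

sumℕ-vanish : ∀ n (F : ℕ → ℤ) → (∀ m → m < n → F m ≡ 0ℤ) → sumℕ n F ≡ 0ℤ
sumℕ-vanish zero    F F≡0 = refl
sumℕ-vanish (suc n) F F≡0 =
  cong₂ _+_ (F≡0 0 z<s) (sumℕ-vanish n (F ∘ suc) (λ m m<n → F≡0 (suc m) (s<s m<n)))

sumℕ-single : ∀ n (F : ℕ → ℤ) t → t < n → (∀ m → m < n → m ≢ t → F m ≡ 0ℤ) →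
  sumℕ n F ≡ F t
sumℕ-single (suc n) F zero t<n F≡0 =
  trans (cong (λ s → F 0 + s) (sumℕ-vanish n (F ∘ suc) (λ m m<n → F≡0 (suc m) (s<s m<n) (λ ()))))
        (ℤP.+-identityʳ (F 0))
sumℕ-single (suc n) F (suc t) (s<s t<n) F≡0 =
  trans (cong (_+ sumℕ n (F ∘ suc)) (F≡0 0 z<s (λ ())))
        (trans (ℤP.+-identityˡ _)
               (sumℕ-single n (F ∘ suc) t t<n
                  (λ m m<n m≢t → F≡0 (suc m) (s<s m<n) (m≢t ∘ ℕP.suc-injective))))

sumℕ-evenOdd : ∀ v (F : ℕ → ℤ) →
  sumℕ (2 ℕ.* v) F ≡ sumℕ v (λ i → F (2 ℕ.* i)) + sumℕ v (λ i → F (suc (2 ℕ.* i)))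
sumℕ-evenOdd zero    F = refl
sumℕ-evenOdd (suc v) F = begin
    sumℕ (2 ℕ.* suc v) F
  ≡⟨ cong (λ N → sumℕ N F) (ℕP.*-suc 2 v) ⟩
    F 0 + (F 1 + sumℕ (2 ℕ.* v) (F ∘ suc ∘ suc))
  ≡⟨ cong (λ s → F 0 + (F 1 + s)) (sumℕ-evenOdd v (F ∘ suc ∘ suc)) ⟩
    F 0 + (F 1 + (sumℕ v (λ i → F (2 ℕ.+ 2 ℕ.* i)) + sumℕ v (λ i → F (3 ℕ.+ 2 ℕ.* i))))
  ≡⟨ regroup (F 0) (F 1) _ _ ⟩
    (F 0 + sumℕ v (λ i → F (2 ℕ.+ 2 ℕ.* i))) + (F 1 + sumℕ v (λ i → F (3 ℕ.+ 2 ℕ.* i)))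
  ≡⟨ sym (cong₂ (λ e o → (F 0 + e) + (F 1 + o))
            (sumℕ-cong v (λ i _ → cong F (ℕP.*-suc 2 i)))
            (sumℕ-cong v (λ i _ → cong (F ∘ suc) (ℕP.*-suc 2 i)))) ⟩
    sumℕ (suc v) (λ i → F (2 ℕ.* i)) + sumℕ (suc v) (λ i → F (suc (2 ℕ.* i))) ∎
  where
  regroup : ∀ a b c d → a + (b + (c + d)) ≡ (a + c) + (b + d)
  regroup = solve-∀

δ : ℕ → ℕ → ℤ
δ zero    zero    = 1ℤ
δ zero    (suc b) = 0ℤ
δ (suc a) zero    = 0ℤ
δ (suc a) (suc b) = δ a b

δ-refl : ∀ a → δ a a ≡ 1ℤ
δ-refl zero    = refl
δ-refl (suc a) = δ-refl a

δ-≢ : ∀ a b → a ≢ b → δ a b ≡ 0ℤ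
δ-≢ zero    zero    a≢b = contradiction refl a≢b
δ-≢ zero    (suc b) a≢b = refl
δ-≢ (suc a) zero    a≢b = refl
δ-≢ (suc a) (suc b) a≢b = δ-≢ a b (a≢b ∘ cong suc)

δ-sym : ∀ a b → δ a b ≡ δ b a
δ-sym zero    zero    = refl
δ-sym zero    (suc b) = refl
δ-sym (suc a) zero    = refl
δ-sym (suc a) (suc b) = δ-sym a b

δ-cong : ∀ {a b c d} → (a ≡ b → c ≡ d) → (c ≡ d → a ≡ b) → δ a b ≡ δ c d
δ-cong {a} {b} {c} {d} ⇒ ⇐ with a ℕ.≟ b
... | yes refl = trans (δ-refl a) (sym (subst (λ x → δ c x ≡ 1ℤ) (⇒ refl) (δ-refl c)))
... | no  a≢b  = trans (δ-≢ a b a≢b) (sym (δ-≢ c d (a≢b ∘ ⇐)))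

sumℕ-δ : ∀ n (F : ℕ → ℤ) t → t < n → sumℕ n (λ m → F m * δ m t) ≡ F t
sumℕ-δ n F t t<n =
  trans (sumℕ-single n _ t t<n (λ m _ m≢t → trans (cong (F m *_) (δ-≢ m t m≢t)) (ℤP.*-zeroʳ (F m))))
        (trans (cong (F t *_) (δ-refl t)) (ℤP.*-identityʳ (F t)))

δ-if : ∀ a b → (if ⌊ a ℕ.≟ b ⌋ then 1ℤ else 0ℤ) ≡ δ a b
δ-if a b with a ℕ.≟ b
... | yes refl = sym (δ-refl a)
... | no  a≢b  = sym (δ-≢ a b a≢b)

entry : ∀ {n} → Matrix n → ℕ → ℕ → ℤ
entry {n} M i j with i <? n | j <? n
... | yes i<n | yes j<n = M (fromℕ< i<n) (fromℕ< j<n)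
... | yes _   | no  _   = 0ℤ
... | no  _   | _       = 0ℤ

entry-fromℕ< : ∀ {n} (M : Matrix n) {i j} (i<n : i < n) (j<n : j < n) →
  entry M i j ≡ M (fromℕ< i<n) (fromℕ< j<n)
entry-fromℕ< {n} M {i} {j} i<n j<n with i <? n | j <? n
... | yes _ | yes _  = refl
... | yes _ | no j≮n = contradiction j<n j≮n
... | no i≮n | _     = contradiction i<n i≮n

entry-toℕ : ∀ {n} (M : Matrix n) (i j : Fin n) → entry M (toℕ i) (toℕ j) ≡ M i j
entry-toℕ M i j =
  trans (entry-fromℕ< M (toℕ<n i) (toℕ<n j)) (cong₂ M (fromℕ<-toℕ i _) (fromℕ<-toℕ j _))

entry-⊗ : ∀ {n} (A B : Matrix n) {i j} → i < n → j < n →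
  entry (A ⊗ B) i j ≡ sumℕ n (λ m → entry A i m * entry B m j)
entry-⊗ {n} A B {i} {j} i<n j<n = trans (entry-fromℕ< (A ⊗ B) i<n j<n) (sumFin≡sumℕ n _ _ factor)
  where
  factor : ∀ m → A (fromℕ< i<n) m * B m (fromℕ< j<n) ≡ entry A i (toℕ m) * entry B (toℕ m) j
  factor m = sym (cong₂ _*_
    (trans (entry-fromℕ< A i<n (toℕ<n m)) (cong (A _) (fromℕ<-toℕ m _)))
    (trans (entry-fromℕ< B (toℕ<n m) j<n) (cong (λ r → B r _) (fromℕ<-toℕ m _))))

entry-⊕ : ∀ {n} (A B : Matrix n) {i j} → i < n → j < n →
  entry (A ⊕ B) i j ≡ entry A i j + entry B i j
entry-⊕ A B i<n j<n = trans (entry-fromℕ< (A ⊕ B) i<n j<n)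
  (sym (cong₂ _+_ (entry-fromℕ< A i<n j<n) (entry-fromℕ< B i<n j<n)))

entry-·M : ∀ {n} x (A : Matrix n) {i j} → i < n → j < n → entry (x ·M A) i j ≡ x * entry A i j
entry-·M x A i<n j<n =
  trans (entry-fromℕ< (x ·M A) i<n j<n) (sym (cong (x *_) (entry-fromℕ< A i<n j<n)))

entry-transpose : ∀ {n} (A : Matrix n) {i j} → i < n → j < n →
  entry (transpose A) i j ≡ entry A j i
entry-transpose A i<n j<n =
  trans (entry-fromℕ< (transpose A) i<n j<n) (sym (entry-fromℕ< A j<n i<n))

entry-zeroM : ∀ {n i j} → i < n → j < n → entry (zeroM n) i j ≡ 0ℤ
entry-zeroM {n} i<n j<n = entry-fromℕ< (zeroM n) i<n j<n

entry-idM : ∀ {n i j} → i < n → j < n → entry (idM n) i j ≡ δ i j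
entry-idM {n} {i} {j} i<n j<n = begin
    entry (idM n) i j
  ≡⟨ entry-fromℕ< (idM n) i<n j<n ⟩
    idM n (fromℕ< i<n) (fromℕ< j<n)
  ≡⟨ δ-if _ _ ⟩
    δ (toℕ (fromℕ< i<n)) (toℕ (fromℕ< j<n))
  ≡⟨ cong₂ δ (toℕ-fromℕ< i<n) (toℕ-fromℕ< j<n) ⟩
    δ i j ∎

entry-N-suc : ∀ {n m j} → m < n → suc j < n → entry (negaShift n) m (suc j) ≡ δ j m
entry-N-suc {n} {m} {j} m<n j+1<n
  rewrite entry-fromℕ< (negaShift n) m<n j+1<n | toℕ-fromℕ< m<n | toℕ-fromℕ< j+1<n
  with suc j ℕ.≟ suc m
... | yes refl = sym (δ-refl j)
... | no  j≢m  with m ℕ.≟ n ∸ 1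
...   | yes _ = sym (δ-≢ j m (j≢m ∘ cong suc))
...   | no  _ = sym (δ-≢ j m (j≢m ∘ cong suc))

entry-N-zero : ∀ {n m} → m < n → entry (negaShift n) m 0 ≡ - δ m (n ∸ 1)
entry-N-zero {n} {m} m<n
  rewrite entry-fromℕ< (negaShift n) m<n (ℕP.≤-trans (s≤s z≤n) m<n)
        | toℕ-fromℕ< m<n | toℕ-fromℕ< {0} (ℕP.≤-trans (s≤s z≤n) m<n)
  with m ℕ.≟ n ∸ 1
... | yes refl = sym (cong -_ (δ-refl m))
... | no  m≢   = sym (cong -_ (δ-≢ m (n ∸ 1) m≢))

-- Nega-Toeplitz arrays: constant along diagonals, with a sign change where a
-- diagonal wraps around from the last column to column 0.  Polynomials in N
-- have this shape, and such an array is determined by its first row.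

record IsNegaToeplitz (n : ℕ) (L : ℕ → ℕ → ℤ) : Set where
  field
    diagonal : ∀ i j → suc i < n → suc j < n → L (suc i) (suc j) ≡ L i j
    wrap     : ∀ i → suc i < n → L (suc i) 0 ≡ - L i (n ∸ 1)
open IsNegaToeplitz

last< : ∀ {n} → 0 < n → n ∸ 1 < n
last< {suc n} _ = ℕP.n<1+n n

negaToeplitz-cong : ∀ {n} {L L′ : ℕ → ℕ → ℤ} → (∀ i j → i < n → j < n → L i j ≡ L′ i j) →
  IsNegaToeplitz n L → IsNegaToeplitz n L′
negaToeplitz-cong {n} L≡L′ T = record
  { diagonal = λ i j i+1<n j+1<n →
      trans (sym (L≡L′ _ _ i+1<n j+1<n))
            (trans (diagonal T i j i+1<n j+1<n) (L≡L′ i j (ℕP.<⇒≤ i+1<n) (ℕP.<⇒≤ j+1<n)))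
  ; wrap = λ i i+1<n →
      trans (sym (L≡L′ _ _ i+1<n (ℕP.m<n⇒0<n i+1<n)))
            (trans (wrap T i i+1<n)
                   (cong -_ (L≡L′ _ _ (ℕP.<⇒≤ i+1<n) (last< (ℕP.m<n⇒0<n i+1<n)))))
  }

negaToeplitz-zero : ∀ n → IsNegaToeplitz n (λ _ _ → 0ℤ)
negaToeplitz-zero n = record { diagonal = λ _ _ _ _ → refl ; wrap = λ _ _ → refl }

δ-beforeLast : ∀ {n} i → suc i < n → δ i (n ∸ 1) ≡ 0ℤ
δ-beforeLast {suc n} i (s<s i<n) = δ-≢ i n (ℕP.<⇒≢ i<n)

negaToeplitz-δ : ∀ n → IsNegaToeplitz n δ
negaToeplitz-δ n = record
  { diagonal = λ _ _ _ _ → refl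
  ; wrap     = λ i i+1<n → sym (cong -_ (δ-beforeLast i i+1<n))
  }

negaToeplitz-lin : ∀ {n} x {L₁ L₂ : ℕ → ℕ → ℤ} → IsNegaToeplitz n L₁ → IsNegaToeplitz n L₂ →
  IsNegaToeplitz n (λ i j → x * L₁ i j + L₂ i j)
negaToeplitz-lin {n} x {L₁} {L₂} T₁ T₂ = record
  { diagonal = λ i j i+1<n j+1<n →
      cong₂ (λ u w → x * u + w) (diagonal T₁ i j i+1<n j+1<n) (diagonal T₂ i j i+1<n j+1<n)
  ; wrap = λ i i+1<n →
      trans (cong₂ (λ u w → x * u + w) (wrap T₁ i i+1<n) (wrap T₂ i i+1<n))
            (negate-lin x (L₁ i (n ∸ 1)) (L₂ i (n ∸ 1)))
  }
  where
  negate-lin : ∀ x a b → x * (- a) + (- b) ≡ - (x * a + b)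
  negate-lin = solve-∀

timesN : ℕ → (ℕ → ℕ → ℤ) → ℕ → ℕ → ℤ
timesN n L i zero    = - L i (n ∸ 1)
timesN n L i (suc j) = L i j

entry-timesN : ∀ {n} (A : Matrix n) i j → i < n → j < n →
  entry (A ⊗ negaShift n) i j ≡ timesN n (entry A) i j
entry-timesN {n} A i zero i<n 0<n = begin
    entry (A ⊗ negaShift n) i 0
  ≡⟨ entry-⊗ A (negaShift n) i<n 0<n ⟩
    sumℕ n (λ m → entry A i m * entry (negaShift n) m 0)
  ≡⟨ sumℕ-cong n (λ m m<n → trans (cong (entry A i m *_) (entry-N-zero m<n))
                                  (sym (ℤP.neg-distribʳ-* (entry A i m) _))) ⟩
    sumℕ n (λ m → - (entry A i m * δ m (n ∸ 1)))
  ≡⟨ sumℕ-neg n _ ⟩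
    - sumℕ n (λ m → entry A i m * δ m (n ∸ 1))
  ≡⟨ cong -_ (sumℕ-δ n (entry A i) (n ∸ 1) (last< 0<n)) ⟩
    - entry A i (n ∸ 1) ∎
entry-timesN {n} A i (suc j) i<n j+1<n = begin
    entry (A ⊗ negaShift n) i (suc j)
  ≡⟨ entry-⊗ A (negaShift n) i<n j+1<n ⟩
    sumℕ n (λ m → entry A i m * entry (negaShift n) m (suc j))
  ≡⟨ sumℕ-cong n (λ m m<n → cong (entry A i m *_) (trans (entry-N-suc m<n j+1<n) (δ-sym j m))) ⟩
    sumℕ n (λ m → entry A i m * δ m j)
  ≡⟨ sumℕ-δ n (entry A i) j (ℕP.<⇒≤ j+1<n) ⟩
    entry A i j ∎

-- Wrap-around in L·N comes from the diagonal invariance of L.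
timesN-wrap : ∀ n {L : ℕ → ℕ → ℤ} → IsNegaToeplitz n L →
  ∀ i → suc i < n → timesN n L (suc i) 0 ≡ - timesN n L i (n ∸ 1)
timesN-wrap (suc zero)     T i (s<s ())
timesN-wrap (suc (suc n′)) T i i+1<n = cong -_ (diagonal T i n′ i+1<n (ℕP.n<1+n _))

negaToeplitz-timesN : ∀ {n} {L : ℕ → ℕ → ℤ} → IsNegaToeplitz n L → IsNegaToeplitz n (timesN n L)
negaToeplitz-timesN {n} {L} T = record { diagonal = shifted ; wrap = timesN-wrap n T }
  where
  shifted : ∀ i j → suc i < n → suc j < n → timesN n L (suc i) (suc j) ≡ timesN n L i j
  shifted i zero    i+1<n _     = wrap T i i+1<n
  shifted i (suc j) i+1<n j+2<n = diagonal T i j i+1<n (ℕP.<⇒≤ j+2<n)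

polyN-negaToeplitz : ∀ {n} (ps : List ℤ) → IsNegaToeplitz n (entry (polyEval ps (negaShift n)))
polyN-negaToeplitz {n} [] =
  negaToeplitz-cong (λ i j i<n j<n → sym (entry-zeroM i<n j<n)) (negaToeplitz-zero n)
polyN-negaToeplitz {n} (p ∷ ps) =
  negaToeplitz-cong horner
    (negaToeplitz-lin p (negaToeplitz-δ n) (negaToeplitz-timesN (polyN-negaToeplitz ps)))
  where
  P : Matrix n
  P = polyEval ps (negaShift n)
  horner : ∀ i j → i < n → j < n →
    p * δ i j + timesN n (entry P) i j ≡ entry (polyEval (p ∷ ps) (negaShift n)) i j
  horner i j i<n j<n = sym (trans (entry-⊕ _ _ i<n j<n)
    (cong₂ _+_ (trans (entry-·M p (idM n) i<n j<n) (cong (p *_) (entry-idM i<n j<n)))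
               (entry-timesN P i j i<n j<n)))

powerN-negaToeplitz : ∀ {n} k → IsNegaToeplitz n (entry (negaShift n ^M k))
powerN-negaToeplitz {n} zero =
  negaToeplitz-cong (λ i j i<n j<n → sym (entry-idM i<n j<n)) (negaToeplitz-δ n)
powerN-negaToeplitz {n} (suc k) =
  negaToeplitz-cong (λ i j i<n j<n → sym (entry-timesN _ i j i<n j<n))
    (negaToeplitz-timesN (powerN-negaToeplitz k))

-- For m < s < n, the index n + m - s of a wrapped-around entry lies strictly
-- between m and n.
<wrapIndex : ∀ {v J i} → i < v → J < v ℕ.+ J ∸ i
<wrapIndex {v} {J} {i} i<v rewrite ℕP.+-∸-comm {v} J (ℕP.<⇒≤ i<v) =
  ℕP.<-≤-trans (ℕP.n<1+n J) (ℕP.+-monoˡ-≤ J (ℕP.m<n⇒0<n∸m i<v))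

wrapIndex< : ∀ {v J k} → J < k → k ≤ v → v ℕ.+ J ∸ k < v
wrapIndex< {v} {J} {k} J<k k≤v =
  ℕP.<-≤-trans (ℕP.∸-monoˡ-< (ℕP.+-monoʳ-< v J<k) (ℕP.≤-trans k≤v (ℕP.m≤m+n v J)))
               (ℕP.≤-reflexive (ℕP.m+n∸n≡m v k))

-- Entry (s, m) of the negacyclic matrix with first row c:
-- c_{m-s} on and above the diagonal, -c_{n+m-s} below it.
negaRot : ℕ → (ℕ → ℤ) → ℕ → ℕ → ℤ
negaRot n c s m with s ≤? m
... | yes _ = c (m ∸ s)
... | no  _ = - c (n ℕ.+ m ∸ s)

negaRot-≤ : ∀ n c {s m} → s ≤ m → negaRot n c s m ≡ c (m ∸ s)
negaRot-≤ n c {s} {m} s≤m with s ≤? m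
... | yes _   = refl
... | no  s≰m = contradiction s≤m s≰m

negaRot-≰ : ∀ n c {s m} → ¬ s ≤ m → negaRot n c s m ≡ - c (n ℕ.+ m ∸ s)
negaRot-≰ n c {s} {m} s≰m with s ≤? m
... | yes s≤m = contradiction s≤m s≰m
... | no  _   = refl

negaRot-suc : ∀ n c s m → negaRot n c (suc s) (suc m) ≡ negaRot n c s m
negaRot-suc n c s m = byCases (s ≤? m)
  where
  byCases : Dec (s ≤ m) → negaRot n c (suc s) (suc m) ≡ negaRot n c s m
  byCases (yes s≤m) = trans (negaRot-≤ n c (s≤s s≤m)) (sym (negaRot-≤ n c s≤m))
  byCases (no  s≰m) =
    trans (negaRot-≰ n c (s≰m ∘ ℕP.≤-pred))
          (trans (cong (λ r → - c (r ∸ suc s)) (ℕP.+-suc n m)) (sym (negaRot-≰ n c s≰m)))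

negaRot-column0 : ∀ n c {s} → 0 < s → negaRot n c s 0 ≡ - c (n ∸ s)
negaRot-column0 n c {suc s} _ =
  trans (negaRot-≰ n c {suc s} {0} (λ ())) (cong (λ r → - c (r ∸ suc s)) (ℕP.+-identityʳ n))

negaRot-cong : ∀ n {c c′ : ℕ → ℤ} → (∀ m → m < n → c m ≡ c′ m) →
  ∀ {s m} → s < n → m < n → negaRot n c s m ≡ negaRot n c′ s m
negaRot-cong n {c} {c′} c≡c′ {s} {m} s<n m<n with s ≤? m
... | yes s≤m = c≡c′ (m ∸ s) (ℕP.≤-<-trans (ℕP.m∸n≤m m s) m<n)
... | no  s≰m = cong -_ (c≡c′ (n ℕ.+ m ∸ s) (wrapIndex< (ℕP.≰⇒> s≰m) (ℕP.<⇒≤ s<n)))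

negaRot-+ : ∀ n (x y : ℕ → ℤ) s m →
  negaRot n (λ j → x j + y j) s m ≡ negaRot n x s m + negaRot n y s m
negaRot-+ n x y s m with s ≤? m
... | yes _ = refl
... | no  _ = ℤP.neg-distrib-+ (x (n ℕ.+ m ∸ s)) (y (n ℕ.+ m ∸ s))

negaToeplitz-firstRow : ∀ {n L} → IsNegaToeplitz n L →
  ∀ i j → i < n → j < n → L i j ≡ negaRot n (L 0) i j
negaToeplitz-firstRow {n} {L} T zero j _ _ = sym (negaRot-≤ n (L 0) z≤n)
negaToeplitz-firstRow {n} {L} T (suc i) (suc j) i+1<n j+1<n = begin
    L (suc i) (suc j)             ≡⟨ diagonal T i j i+1<n j+1<n ⟩
    L i j                         ≡⟨ negaToeplitz-firstRow T i j (ℕP.<⇒≤ i+1<n) (ℕP.<⇒≤ j+1<n) ⟩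
    negaRot n (L 0) i j           ≡⟨ sym (negaRot-suc n (L 0) i j) ⟩
    negaRot n (L 0) (suc i) (suc j) ∎
negaToeplitz-firstRow {suc n} {L} T (suc i) zero (s<s i<n) _ = begin
    L (suc i) 0                     ≡⟨ wrap T i (s<s i<n) ⟩
    - L i n                         ≡⟨ cong -_ (negaToeplitz-firstRow T i n (ℕP.m<n⇒m<1+n i<n) (ℕP.n<1+n n)) ⟩
    - negaRot (suc n) (L 0) i n     ≡⟨ cong -_ (negaRot-≤ (suc n) (L 0) (ℕP.<⇒≤ i<n)) ⟩
    - L 0 (n ∸ i)                   ≡⟨ sym (negaRot-column0 (suc n) (L 0) {suc i} z<s) ⟩
    negaRot (suc n) (L 0) (suc i) 0 ∎

-- Powers of N and the negaperiodic autocorrelation.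

powerN-row0 : ∀ {v} k → k < v → ∀ j → j < v → entry (negaShift v ^M k) 0 j ≡ δ j k
powerN-row0 zero    k<v j j<v = trans (entry-idM k<v j<v) (δ-sym 0 j)
powerN-row0 {v} (suc k) k<v zero 0<v = begin
    entry (negaShift v ^M suc k) 0 0      ≡⟨ entry-timesN (negaShift v ^M k) 0 0 0<v 0<v ⟩
    - entry (negaShift v ^M k) 0 (v ∸ 1)  ≡⟨ cong -_ (powerN-row0 k (ℕP.<⇒≤ k<v) (v ∸ 1) (last< 0<v)) ⟩
    - δ (v ∸ 1) k                         ≡⟨ cong -_ (trans (δ-sym (v ∸ 1) k) (δ-beforeLast k k<v)) ⟩
    0ℤ                                    ∎
powerN-row0 {v} (suc k) k<v (suc j) j+1<v =
  trans (entry-timesN (negaShift v ^M k) 0 (suc j) (ℕP.m<n⇒0<n j+1<v) j+1<v)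
        (powerN-row0 k (ℕP.<⇒≤ k<v) j (ℕP.<⇒≤ j+1<v))

entry-powerN : ∀ {v k i j} → k < v → i < v → j < v →
  entry (negaShift v ^M k) i j ≡ negaRot v (λ m → δ m k) i j
entry-powerN {v} {k} {i} {j} k<v i<v j<v =
  trans (negaToeplitz-firstRow (powerN-negaToeplitz k) i j i<v j<v)
        (negaRot-cong v (λ m m<v → powerN-row0 k k<v m m<v) i<v j<v)

∸-swap : ∀ {a i k} → i ≤ a → a ∸ i ≡ k → a ∸ k ≡ i
∸-swap {a} i≤a refl = ℕP.m∸[m∸n]≡n i≤a

powerN-column-≤ : ∀ {v k i J} → k ≤ J → i < v →
  negaRot v (λ m → δ m k) i J ≡ δ i (J ∸ k)
powerN-column-≤ {v} {k} {i} {J} k≤J i<v with i ≤? J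
... | yes i≤J = δ-cong (λ e → sym (∸-swap i≤J e)) (λ e → ∸-swap k≤J (sym e))
... | no  i≰J = trans (cong -_ (δ-≢ _ k (λ e → ℕP.<⇒≢ (ℕP.≤-<-trans k≤J (<wrapIndex i<v)) (sym e))))
                      (sym (δ-≢ i (J ∸ k) (λ e → i≰J (subst (_≤ J) (sym e) (ℕP.m∸n≤m J k)))))

powerN-column-> : ∀ {v k i J} → J < k → k < v → i < v →
  negaRot v (λ m → δ m k) i J ≡ - δ i (v ℕ.+ J ∸ k)
powerN-column-> {v} {k} {i} {J} J<k k<v i<v with i ≤? J
... | yes i≤J = trans (δ-≢ (J ∸ i) k (λ e → ℕP.<⇒≢ (ℕP.≤-<-trans (subst (_≤ J) e (ℕP.m∸n≤m J i)) J<k) refl))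
                      (sym (cong -_ (δ-≢ i _ (λ e → ℕP.<⇒≢ (ℕP.≤-<-trans i≤J (<wrapIndex k<v)) e))))
... | no  i≰J = cong -_ (δ-cong (λ e → sym (∸-swap i≤v+J e)) (λ e → ∸-swap k≤v+J (sym e)))
  where
  i≤v+J : i ≤ v ℕ.+ J
  i≤v+J = ℕP.≤-trans (ℕP.<⇒≤ i<v) (ℕP.m≤m+n v J)
  k≤v+J : k ≤ v ℕ.+ J
  k≤v+J = ℕP.≤-trans (ℕP.<⇒≤ k<v) (ℕP.m≤m+n v J)

rowTimesPowerN : ∀ v (x : ℕ → ℤ) {k J} → k < v → J < v →
  sumℕ v (λ i → x i * negaRot v (λ m → δ m k) i J) ≡ negaRot v x k J
rowTimesPowerN v x {k} {J} k<v J<v with k ≤? J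
... | yes k≤J = begin
    sumℕ v (λ i → x i * negaRot v (λ m → δ m k) i J)
  ≡⟨ sumℕ-cong v (λ i i<v → cong (x i *_) (powerN-column-≤ k≤J i<v)) ⟩
    sumℕ v (λ i → x i * δ i (J ∸ k))
  ≡⟨ sumℕ-δ v x (J ∸ k) (ℕP.≤-<-trans (ℕP.m∸n≤m J k) J<v) ⟩
    x (J ∸ k) ∎
... | no  k≰J = begin
    sumℕ v (λ i → x i * negaRot v (λ m → δ m k) i J)
  ≡⟨ sumℕ-cong v (λ i i<v → trans (cong (x i *_) (powerN-column-> J<k k<v i<v))
                                  (sym (ℤP.neg-distribʳ-* (x i) _))) ⟩
    sumℕ v (λ i → - (x i * δ i t))
  ≡⟨ sumℕ-neg v _ ⟩
    - sumℕ v (λ i → x i * δ i t)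
  ≡⟨ cong -_ (sumℕ-δ v x t (wrapIndex< J<k (ℕP.<⇒≤ k<v))) ⟩
    - x t ∎
  where
  J<k : J < k
  J<k = ℕP.≰⇒> k≰J
  t : ℕ
  t = v ℕ.+ J ∸ k

autocorr : ℕ → (ℕ → ℤ) → ℕ → ℤ
autocorr v x k = sumℕ v (λ j → x j * negaRot v x k j)

NAF≡autocorr : ∀ {v} (a : Seq v) (x : ℕ → ℤ) → (∀ i → a i ≡ x (toℕ i)) →
  ∀ {k} → k < v → NAF a k ≡ autocorr v x k
NAF≡autocorr {v} a x a≡x {k} k<v = sumFin≡sumℕ v _ _ (λ j → cong₂ _*_ (a≡x j) (shifted j))
  where
  shifted : ∀ j → vecMat a (negaShift v ^M k) j ≡ negaRot v x k (toℕ j)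
  shifted j = trans
    (sumFin≡sumℕ v _ (λ i → x i * negaRot v (λ m → δ m k) i (toℕ j))
       (λ i → cong₂ _*_ (a≡x i) (trans (sym (entry-toℕ _ i j)) (entry-powerN k<v (toℕ<n i) (toℕ<n j)))))
    (rowTimesPowerN v x k<v (toℕ<n j))

-- Divisibility by 4 of sums of ±1 products.

by4 : ∀ {x} → True (+ 4 ∣? x) → + 4 ∣ x
by4 {x} = toWitness {a? = + 4 ∣? x}

notBy4 : ∀ {x} → False (+ 4 ∣? x) → ¬ (+ 4 ∣ x)
notBy4 {x} = toWitnessFalse {a? = + 4 ∣? x}

∣-sumℕ : ∀ {d} n (F : ℕ → ℤ) → (∀ m → m < n → d ∣ F m) → d ∣ sumℕ n F
∣-sumℕ {d} zero    F d∣F = divides 0ℤ (sym (ℤP.*-zeroˡ d))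
∣-sumℕ {d} (suc n) F d∣F =
  ∣m∣n⇒∣m+n (d∣F 0 z<s) (∣-sumℕ n (F ∘ suc) (λ m m<n → d∣F (suc m) (s<s m<n)))

omit : ℕ → (ℕ → ℤ) → ℕ → ℤ
omit t F m = (1ℤ - δ m t) * F m

omit-≢ : ∀ {t} (F : ℕ → ℤ) {m} → m ≢ t → omit t F m ≡ F m
omit-≢ {t} F {m} m≢t = trans (cong (λ e → (1ℤ - e) * F m) (δ-≢ m t m≢t)) (ℤP.*-identityˡ (F m))

∣-omit : ∀ {d} t (F : ℕ → ℤ) m → (m ≢ t → d ∣ F m) → d ∣ omit t F m
∣-omit {d} t F m d∣F with m ℕ.≟ t
... | yes refl = subst (d ∣_) (sym (trans (cong (λ e → (1ℤ - e) * F m) (δ-refl m)) (ℤP.*-zeroˡ (F m))))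
                       (divides 0ℤ (sym (ℤP.*-zeroˡ d)))
... | no  m≢t  = subst (d ∣_) (sym (omit-≢ F m≢t)) (d∣F m≢t)

sumℕ-omit : ∀ n (F : ℕ → ℤ) {t} → t < n → sumℕ n F ≡ F t + sumℕ n (omit t F)
sumℕ-omit n F {t} t<n = begin
    sumℕ n F
  ≡⟨ sumℕ-cong n (λ m _ → split (F m) (δ m t)) ⟩
    sumℕ n (λ m → F m * δ m t + omit t F m)
  ≡⟨ sumℕ-+ n _ _ ⟩
    sumℕ n (λ m → F m * δ m t) + sumℕ n (omit t F)
  ≡⟨ cong (_+ sumℕ n (omit t F)) (sumℕ-δ n F t t<n) ⟩
    F t + sumℕ n (omit t F) ∎
  where
  split : ∀ f e → f ≡ f * e + (1ℤ - e) * f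
  split = solve-∀

sumℕ-except3 : ∀ {d} n (F : ℕ → ℤ) {p q r} → p < n → q < n → r < n →
  q ≢ p → r ≢ p → r ≢ q → (∀ m → m < n → m ≢ p → m ≢ q → m ≢ r → d ∣ F m) →
  d ∣ sumℕ n F - (F p + F q + F r)
sumℕ-except3 {d} n F {p} {q} {r} p<n q<n r<n q≢p r≢p r≢q d∣F =
  subst (d ∣_) (sym remainder) (∣-sumℕ n G d∣G)
  where
  G : ℕ → ℤ
  G = omit r (omit q (omit p F))
  d∣G : ∀ m → m < n → d ∣ G m
  d∣G m m<n = ∣-omit r (omit q (omit p F)) m λ m≢r → ∣-omit q (omit p F) m λ m≢q → ∣-omit p F m λ m≢p →
    d∣F m m<n m≢p m≢q m≢r
  split : sumℕ n F ≡ F p + (F q + (F r + sumℕ n G))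
  split = begin
      sumℕ n F
    ≡⟨ sumℕ-omit n F p<n ⟩
      F p + sumℕ n (omit p F)
    ≡⟨ cong (λ s → F p + s) (sumℕ-omit n _ q<n) ⟩
      F p + (omit p F q + sumℕ n (omit q (omit p F)))
    ≡⟨ cong (λ s → F p + (omit p F q + s)) (sumℕ-omit n _ r<n) ⟩
      F p + (omit p F q + (omit q (omit p F) r + sumℕ n G))
    ≡⟨ cong₂ (λ y z → F p + (y + (z + sumℕ n G)))
             (omit-≢ F q≢p) (trans (omit-≢ (omit p F) r≢q) (omit-≢ F r≢p)) ⟩
      F p + (F q + (F r + sumℕ n G)) ∎
  remainder : sumℕ n F - (F p + F q + F r) ≡ sumℕ n G
  remainder = trans (cong (_- (F p + F q + F r)) split) (cancel (F p) (F q) (F r) (sumℕ n G))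
    where
    cancel : ∀ a b c s → a + (b + (c + s)) - (a + b + c) ≡ s
    cancel = solve-∀

-- (x + y)(x + z) ∈ {0, 4} for x, y, z = ±1.
pm-product-by4 : ∀ {x y z} → IsPM1 x → IsPM1 y → IsPM1 z → + 4 ∣ (x + y) * (x + z)
pm-product-by4 (inj₁ refl) (inj₁ refl) (inj₁ refl) = by4 _
pm-product-by4 (inj₁ refl) (inj₁ refl) (inj₂ refl) = by4 _
pm-product-by4 (inj₁ refl) (inj₂ refl) (inj₁ refl) = by4 _
pm-product-by4 (inj₁ refl) (inj₂ refl) (inj₂ refl) = by4 _
pm-product-by4 (inj₂ refl) (inj₁ refl) (inj₁ refl) = by4 _
pm-product-by4 (inj₂ refl) (inj₁ refl) (inj₂ refl) = by4 _
pm-product-by4 (inj₂ refl) (inj₂ refl) (inj₁ refl) = by4 _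
pm-product-by4 (inj₂ refl) (inj₂ refl) (inj₂ refl) = by4 _

rowTriple : (ℕ → ℕ → ℤ) → ℕ → ℕ → ℕ → ℕ → ℤ
rowTriple L p q r m = (L p m + L q m) * (L p m + L r m)

threeRows-by4 : ∀ n (L : ℕ → ℕ → ℤ) {p q r} → p < n → q < n → r < n →
  q ≢ p → r ≢ p → r ≢ q →
  (∀ i m → i < n → m < n → i ≢ m → IsPM1 (L i m)) →
  (∀ i j → i < n → j < n → sumℕ n (λ m → L i m * L j m) ≡ + (n ∸ 1) * δ i j) →
  + 4 ∣ + (n ∸ 1) - (rowTriple L p q r p + rowTriple L p q r q + rowTriple L p q r r)
threeRows-by4 n L {p} {q} {r} p<n q<n r<n q≢p r≢p r≢q L-pm orthogonal =
  subst (λ s → + 4 ∣ s - (F p + F q + F r)) total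
    (sumℕ-except3 n F p<n q<n r<n q≢p r≢p r≢q
      (λ m m<n m≢p m≢q m≢r → pm-product-by4 (L-pm p m p<n m<n (m≢p ∘ sym))
                               (L-pm q m q<n m<n (m≢q ∘ sym)) (L-pm r m r<n m<n (m≢r ∘ sym))))
  where
  F : ℕ → ℤ
  F = rowTriple L p q r
  ⟨_,_⟩ : ℕ → ℕ → ℤ
  ⟨ i , j ⟩ = sumℕ n (λ m → L i m * L j m)
  total : sumℕ n F ≡ + (n ∸ 1)
  total = begin
      sumℕ n F
    ≡⟨ sumℕ-bilinear n (L p) (L q) (L p) (L r) ⟩
      ⟨ p , p ⟩ + ⟨ p , r ⟩ + ⟨ q , p ⟩ + ⟨ q , r ⟩
    ≡⟨ cong₂ _+_ (cong₂ _+_ (cong₂ _+_ (orthogonal p p p<n p<n) (orthogonal p r p<n r<n))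
                            (orthogonal q p q<n p<n)) (orthogonal q r q<n r<n) ⟩
      + (n ∸ 1) * δ p p + + (n ∸ 1) * δ p r + + (n ∸ 1) * δ q p + + (n ∸ 1) * δ q r
    ≡⟨ cong₂ _+_ (cong₂ _+_ (cong₂ _+_ (cong (+ (n ∸ 1) *_) (δ-refl p))
                                       (cong (+ (n ∸ 1) *_) (δ-≢ p r (r≢p ∘ sym))))
                            (cong (+ (n ∸ 1) *_) (δ-≢ q p q≢p)))
                 (cong (+ (n ∸ 1) *_) (δ-≢ q r (r≢q ∘ sym))) ⟩
      + (n ∸ 1) * 1ℤ + + (n ∸ 1) * 0ℤ + + (n ∸ 1) * 0ℤ + + (n ∸ 1) * 0ℤ
    ≡⟨ diagonalOnly (+ (n ∸ 1)) ⟩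
      + (n ∸ 1) ∎
    where
    diagonalOnly : ∀ a → a * 1ℤ + a * 0ℤ + a * 0ℤ + a * 0ℤ ≡ a
    diagonalOnly = solve-∀

-- The three exceptional terms for rows and columns 0, k, 2k of a negacyclic
-- conference matrix, with α = c_k, β = c_{n-k}, γ = c_{2k}, ε = c_{n-2k}.
cornerSum : ℤ → ℤ → ℤ → ℤ → ℤ
cornerSum α β γ ε = (0ℤ + - β) * (0ℤ + - ε) + (α + 0ℤ) * (α + - β) + (γ + α) * (γ + 0ℤ)

-- cornerSum ≡ 3 (mod 4) forces γ = ε: otherwise cornerSum ∈ {1, 5}.
cornerSum-by4 : ∀ {α β γ ε} → IsPM1 α → IsPM1 β → IsPM1 γ → IsPM1 ε →
  + 4 ∣ cornerSum α β γ ε + 1ℤ → γ ≡ ε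
cornerSum-by4 _ _ (inj₁ refl) (inj₁ refl) _ = refl
cornerSum-by4 _ _ (inj₂ refl) (inj₂ refl) _ = refl
cornerSum-by4 (inj₁ refl) (inj₁ refl) (inj₁ refl) (inj₂ refl) 4∣ = ⊥-elim (notBy4 _ 4∣)
cornerSum-by4 (inj₁ refl) (inj₂ refl) (inj₁ refl) (inj₂ refl) 4∣ = ⊥-elim (notBy4 _ 4∣)
cornerSum-by4 (inj₂ refl) (inj₁ refl) (inj₁ refl) (inj₂ refl) 4∣ = ⊥-elim (notBy4 _ 4∣)
cornerSum-by4 (inj₂ refl) (inj₂ refl) (inj₁ refl) (inj₂ refl) 4∣ = ⊥-elim (notBy4 _ 4∣)
cornerSum-by4 (inj₁ refl) (inj₁ refl) (inj₂ refl) (inj₁ refl) 4∣ = ⊥-elim (notBy4 _ 4∣)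
cornerSum-by4 (inj₁ refl) (inj₂ refl) (inj₂ refl) (inj₁ refl) 4∣ = ⊥-elim (notBy4 _ 4∣)
cornerSum-by4 (inj₂ refl) (inj₁ refl) (inj₂ refl) (inj₁ refl) 4∣ = ⊥-elim (notBy4 _ 4∣)
cornerSum-by4 (inj₂ refl) (inj₂ refl) (inj₂ refl) (inj₁ refl) 4∣ = ⊥-elim (notBy4 _ 4∣)

-- Even and odd subsequences.

negaRot-even : ∀ v c {k} i →
  negaRot (2 ℕ.* v) c (2 ℕ.* k) (2 ℕ.* i) ≡ negaRot v (λ j → c (2 ℕ.* j)) k i
negaRot-even v c {k} i with k ≤? i
... | yes k≤i = trans (negaRot-≤ _ c (ℕP.*-monoʳ-≤ 2 k≤i)) (cong c (sym (ℕP.*-distribˡ-∸ 2 i k)))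
... | no  k≰i = trans (negaRot-≰ _ c (k≰i ∘ ℕP.*-cancelˡ-≤ 2)) (cong (λ m → - c m) wrapped)
  where
  wrapped : 2 ℕ.* v ℕ.+ 2 ℕ.* i ∸ 2 ℕ.* k ≡ 2 ℕ.* (v ℕ.+ i ∸ k)
  wrapped = trans (cong (_∸ 2 ℕ.* k) (sym (ℕP.*-distribˡ-+ 2 v i)))
                  (sym (ℕP.*-distribˡ-∸ 2 (v ℕ.+ i) k))

negaRot-odd : ∀ v c {k} i → k < v →
  negaRot (2 ℕ.* v) c (2 ℕ.* k) (suc (2 ℕ.* i)) ≡ negaRot v (λ j → c (suc (2 ℕ.* j))) k i
negaRot-odd v c {k} i k<v with k ≤? i
... | yes k≤i = trans (negaRot-≤ _ c (ℕP.≤-trans 2k≤2i (ℕP.n≤1+n _))) (cong c shifted)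
  where
  2k≤2i : 2 ℕ.* k ≤ 2 ℕ.* i
  2k≤2i = ℕP.*-monoʳ-≤ 2 k≤i
  shifted : suc (2 ℕ.* i) ∸ 2 ℕ.* k ≡ suc (2 ℕ.* (i ∸ k))
  shifted = trans (ℕP.+-∸-assoc 1 2k≤2i) (cong suc (sym (ℕP.*-distribˡ-∸ 2 i k)))
... | no  k≰i = trans (negaRot-≰ _ c (ℕP.<⇒≱ 2i+1<2k)) (cong (λ m → - c m) wrapped)
  where
  2i+1<2k : suc (2 ℕ.* i) < 2 ℕ.* k
  2i+1<2k = subst (_≤ 2 ℕ.* k) (ℕP.*-suc 2 i) (ℕP.*-monoʳ-≤ 2 (ℕP.≰⇒> k≰i))
  2k≤2v+2i : 2 ℕ.* k ≤ 2 ℕ.* (v ℕ.+ i)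
  2k≤2v+2i = ℕP.*-monoʳ-≤ 2 (ℕP.≤-trans (ℕP.<⇒≤ k<v) (ℕP.m≤m+n v i))
  wrapped : 2 ℕ.* v ℕ.+ suc (2 ℕ.* i) ∸ 2 ℕ.* k ≡ suc (2 ℕ.* (v ℕ.+ i ∸ k))
  wrapped = begin
      2 ℕ.* v ℕ.+ suc (2 ℕ.* i) ∸ 2 ℕ.* k
    ≡⟨ cong (_∸ 2 ℕ.* k) (trans (ℕP.+-suc (2 ℕ.* v) _) (cong suc (sym (ℕP.*-distribˡ-+ 2 v i)))) ⟩
      suc (2 ℕ.* (v ℕ.+ i)) ∸ 2 ℕ.* k
    ≡⟨ ℕP.+-∸-assoc 1 2k≤2v+2i ⟩
      suc (2 ℕ.* (v ℕ.+ i) ∸ 2 ℕ.* k)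
    ≡⟨ cong suc (sym (ℕP.*-distribˡ-∸ 2 (v ℕ.+ i) k)) ⟩
      suc (2 ℕ.* (v ℕ.+ i ∸ k)) ∎

autocorr-evenOdd : ∀ v (c : ℕ → ℤ) {k} → k < v →
  autocorr (2 ℕ.* v) c (2 ℕ.* k) ≡
  autocorr v (λ j → c (2 ℕ.* j)) k + autocorr v (λ j → c (suc (2 ℕ.* j))) k
autocorr-evenOdd v c {k} k<v = trans (sumℕ-evenOdd v _)
  (cong₂ _+_ (sumℕ-cong v (λ i _ → cong (c (2 ℕ.* i) *_) (negaRot-even v c {k} i)))
             (sumℕ-cong v (λ i _ → cong (c (suc (2 ℕ.* i)) *_) (negaRot-odd v c i k<v))))

autocorr-cong : ∀ v {x y : ℕ → ℤ} → (∀ j → j < v → x j ≡ y j) →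
  ∀ {k} → k < v → autocorr v x k ≡ autocorr v y k
autocorr-cong v x≡y k<v =
  sumℕ-cong v (λ j j<v → cong₂ _*_ (x≡y j j<v) (negaRot-cong v x≡y k<v j<v))

autocorr-bumpFirst : ∀ v (x : ℕ → ℤ) {k} → 0 < k → k < v →
  autocorr v (λ j → x j + δ j 0) k ≡ autocorr v x k + (x k - x (v ∸ k))
autocorr-bumpFirst v x {k} 0<k k<v = begin
    autocorr v (λ j → x j + e j) k
  ≡⟨ sumℕ-cong v (λ j _ → cong ((x j + e j) *_) (negaRot-+ v x e k j)) ⟩
    sumℕ v (λ j → (x j + e j) * (ρx j + ρe j))
  ≡⟨ sumℕ-bilinear v x e ρx ρe ⟩
    autocorr v x k + sumℕ v (λ j → x j * ρe j) + sumℕ v (λ j → e j * ρx j) + sumℕ v (λ j → e j * ρe j)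
  ≡⟨ cong₂ _+_ (cong₂ _+_ (cong (λ s → autocorr v x k + s) x·ρe) e·ρx) e·ρe ⟩
    autocorr v x k + x k + - x (v ∸ k) + 0ℤ
  ≡⟨ regroup (autocorr v x k) (x k) (x (v ∸ k)) ⟩
    autocorr v x k + (x k - x (v ∸ k)) ∎
  where
  e ρx ρe : ℕ → ℤ
  e j = δ j 0
  ρx = negaRot v x k
  ρe = negaRot v e k
  ρe≡δ : ∀ j → ρe j ≡ δ j k
  ρe≡δ j = trans (powerN-column-≤ {v} {0} {k} {j} z≤n k<v) (δ-sym k j)
  e-picksFirst : ∀ (f : ℕ → ℤ) → sumℕ v (λ j → e j * f j) ≡ f 0
  e-picksFirst f = trans (sumℕ-cong v (λ j _ → ℤP.*-comm (e j) (f j)))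
                         (sumℕ-δ v f 0 (ℕP.m<n⇒0<n k<v))
  x·ρe : sumℕ v (λ j → x j * ρe j) ≡ x k
  x·ρe = trans (sumℕ-cong v (λ j _ → cong (x j *_) (ρe≡δ j))) (sumℕ-δ v x k k<v)
  e·ρx : sumℕ v (λ j → e j * ρx j) ≡ - x (v ∸ k)
  e·ρx = trans (e-picksFirst ρx) (negaRot-column0 v x 0<k)
  e·ρe : sumℕ v (λ j → e j * ρe j) ≡ 0ℤ
  e·ρe = trans (e-picksFirst ρe) (trans (ρe≡δ 0) (δ-≢ 0 k (ℕP.<⇒≢ 0<k)))
  regroup : ∀ a b c → a + b + - c + 0ℤ ≡ a + (b - c)
  regroup = solve-∀

-- Negacyclic conference matrices.

entry-firstRow : ∀ {n} (C : Matrix n) m → entry C 0 m ≡ firstRow C m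
entry-firstRow {zero}  C m = refl
entry-firstRow {suc n} C m with m <? suc n
... | yes _ = refl
... | no  _ = refl

negaToeplitz-translate : ∀ {n L} → IsNegaToeplitz n L → ∀ d {s m} →
  d ℕ.+ s < n → d ℕ.+ m < n → L (d ℕ.+ s) (d ℕ.+ m) ≡ L s m
negaToeplitz-translate T zero    _     _     = refl
negaToeplitz-translate T (suc d) d+s<n d+m<n =
  trans (diagonal T _ _ d+s<n d+m<n) (negaToeplitz-translate T d (ℕP.<⇒≤ d+s<n) (ℕP.<⇒≤ d+m<n))

2k≡k+k : ∀ k → 2 ℕ.* k ≡ k ℕ.+ k
2k≡k+k k = cong (k ℕ.+_) (ℕP.+-identityʳ k)

-- The even- and odd-indexed subsequences of c, and the sequence a of the
-- theorem: c's even subsequence with its first entry (c₀ = 0) replaced by 1.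
evens odds evenWithOne : (ℕ → ℤ) → ℕ → ℤ
evens c j = c (2 ℕ.* j)
odds  c j = c (suc (2 ℕ.* j))
evenWithOne c zero    = 1ℤ
evenWithOne c (suc j) = c (2 ℕ.* suc j)

seqA≡evenWithOne : ∀ {n} (C : Matrix n) v (i : Fin v) →
  seqA C v i ≡ evenWithOne (firstRow C) (toℕ i)
seqA≡evenWithOne C v i with toℕ i
... | zero  = refl
... | suc m = refl

module NegacyclicConference {n : ℕ} (C : Matrix n) (conf : IsConference C) (neg : IsNegacyclic C) where

  L : ℕ → ℕ → ℤ
  L = entry C

  c : ℕ → ℤ
  c = firstRow C

  L-diagonal : ∀ i → i < n → L i i ≡ 0ℤ
  L-diagonal i i<n = trans (entry-fromℕ< C i<n i<n) (proj₁ conf (fromℕ< i<n))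

  L-pm : ∀ i m → i < n → m < n → i ≢ m → IsPM1 (L i m)
  L-pm i m i<n m<n i≢m = subst IsPM1 (sym (entry-fromℕ< C i<n m<n))
    (proj₁ (proj₂ conf) (fromℕ< i<n) (fromℕ< m<n)
      (λ e → i≢m (trans (sym (toℕ-fromℕ< i<n)) (trans (cong toℕ e) (toℕ-fromℕ< m<n)))))

  L-orthogonal : ∀ i j → i < n → j < n → sumℕ n (λ m → L i m * L j m) ≡ + (n ∸ 1) * δ i j
  L-orthogonal i j i<n j<n = begin
      sumℕ n (λ m → L i m * L j m)
    ≡⟨ sumℕ-cong n (λ m m<n → cong (L i m *_) (sym (entry-transpose C m<n j<n))) ⟩
      sumℕ n (λ m → L i m * entry (transpose C) m j)
    ≡⟨ sym (entry-⊗ C (transpose C) i<n j<n) ⟩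
      entry (C ⊗ transpose C) i j
    ≡⟨ entry-fromℕ< _ i<n j<n ⟩
      (C ⊗ transpose C) (fromℕ< i<n) (fromℕ< j<n)
    ≡⟨ proj₂ (proj₂ conf) (fromℕ< i<n) (fromℕ< j<n) ⟩
      ((+ (n ∸ 1)) ·M idM n) (fromℕ< i<n) (fromℕ< j<n)
    ≡⟨ sym (entry-fromℕ< _ i<n j<n) ⟩
      entry ((+ (n ∸ 1)) ·M idM n) i j
    ≡⟨ entry-·M (+ (n ∸ 1)) (idM n) i<n j<n ⟩
      + (n ∸ 1) * entry (idM n) i j
    ≡⟨ cong (+ (n ∸ 1) *_) (entry-idM i<n j<n) ⟩
      + (n ∸ 1) * δ i j ∎

  L-negaToeplitz : IsNegaToeplitz n L
  L-negaToeplitz = negaToeplitz-cong isPoly (polyN-negaToeplitz (proj₁ neg))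
    where
    isPoly : ∀ i j → i < n → j < n → entry (polyEval (proj₁ neg) (negaShift n)) i j ≡ L i j
    isPoly i j i<n j<n = trans (entry-fromℕ< _ i<n j<n)
      (trans (sym (proj₂ neg _ _)) (sym (entry-fromℕ< C i<n j<n)))

  L≡negaRot : ∀ s m → s < n → m < n → L s m ≡ negaRot n c s m
  L≡negaRot s m s<n m<n = trans (negaToeplitz-firstRow L-negaToeplitz s m s<n m<n)
                                (negaRot-cong n (λ j _ → entry-firstRow C j) s<n m<n)

  L-column0 : ∀ {s} → 0 < s → s < n → L s 0 ≡ - c (n ∸ s)
  L-column0 {s} 0<s s<n = trans (L≡negaRot s 0 s<n (ℕP.m<n⇒0<n s<n)) (negaRot-column0 n c 0<s)

  c-zero : 0 < n → c 0 ≡ 0ℤ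
  c-zero 0<n = trans (sym (entry-firstRow C 0)) (L-diagonal 0 0<n)

  c-pm : ∀ {m} → 0 < m → m < n → IsPM1 (c m)
  c-pm {m} 0<m m<n =
    subst IsPM1 (entry-firstRow C m) (L-pm 0 m (ℕP.m<n⇒0<n m<n) m<n (ℕP.<⇒≢ 0<m))

  c-pm-tail : ∀ {s} → 0 < s → s < n → IsPM1 (c (n ∸ s))
  c-pm-tail 0<s s<n = c-pm (ℕP.m<n⇒0<n∸m s<n) (ℕP.∸-monoʳ-< 0<s (ℕP.<⇒≤ s<n))

  -- Orthogonality of rows 0 and s: the first row has zero autocorrelation.
  autocorr-c : ∀ {s} → 0 < s → s < n → autocorr n c s ≡ 0ℤ
  autocorr-c {s} 0<s s<n = begin
      autocorr n c s
    ≡⟨ sumℕ-cong n (λ m m<n → sym (cong₂ _*_ (entry-firstRow C m) (L≡negaRot s m s<n m<n))) ⟩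
      sumℕ n (λ m → L 0 m * L s m)
    ≡⟨ L-orthogonal 0 s (ℕP.m<n⇒0<n s<n) s<n ⟩
      + (n ∸ 1) * δ 0 s
    ≡⟨ cong (+ (n ∸ 1) *_) (δ-≢ 0 s (ℕP.<⇒≢ 0<s)) ⟩
      + (n ∸ 1) * 0ℤ
    ≡⟨ ℤP.*-zeroʳ (+ (n ∸ 1)) ⟩
      0ℤ ∎

  -- The mod-4 argument on rows and columns 0, k, 2k: c_{2k} = c_{n-2k}.
  evenSymmetry : + 4 ∣ + n → ∀ {k} → 0 < k → 2 ℕ.* k < n → c (2 ℕ.* k) ≡ c (n ∸ 2 ℕ.* k)
  evenSymmetry 4∣n {k} 0<k 2k<n =
    cornerSum-by4 (c-pm 0<k k<n) (c-pm-tail 0<k k<n) (c-pm 0<2k 2k<n) (c-pm-tail 0<2k 2k<n)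
      4∣corners+1
    where
    k<2k : k < 2 ℕ.* k
    k<2k = subst (k <_) (sym (2k≡k+k k)) (ℕP.m<m+n k 0<k)
    0<2k : 0 < 2 ℕ.* k
    0<2k = ℕP.<-trans 0<k k<2k
    k<n : k < n
    k<n = ℕP.<-trans k<2k 2k<n
    0<n : 0 < n
    0<n = ℕP.<-trans 0<k k<n
    k+k<n : k ℕ.+ k < n
    k+k<n = subst (_< n) (2k≡k+k k) 2k<n
    k+0<n : k ℕ.+ 0 < n
    k+0<n = subst (_< n) (sym (ℕP.+-identityʳ k)) k<n
    L-2k-k : L (2 ℕ.* k) k ≡ L k 0
    L-2k-k = subst₂ (λ a b → L a b ≡ L k 0) (sym (2k≡k+k k)) (ℕP.+-identityʳ k)
                    (negaToeplitz-translate L-negaToeplitz k k+k<n k+0<n)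
    L-k-2k : L k (2 ℕ.* k) ≡ L 0 k
    L-k-2k = subst₂ (λ a b → L a b ≡ L 0 k) (ℕP.+-identityʳ k) (sym (2k≡k+k k))
                    (negaToeplitz-translate L-negaToeplitz k k+0<n k+k<n)
    F : ℕ → ℤ
    F = rowTriple L 0 k (2 ℕ.* k)
    corners : F 0 + F k + F (2 ℕ.* k) ≡ cornerSum (c k) (c (n ∸ k)) (c (2 ℕ.* k)) (c (n ∸ 2 ℕ.* k))
    corners = cong₂ _+_
      (cong₂ _+_
        (cong₂ _*_ (cong₂ _+_ (L-diagonal 0 0<n) (L-column0 0<k k<n))
                   (cong₂ _+_ (L-diagonal 0 0<n) (L-column0 0<2k 2k<n)))
        (cong₂ _*_ (cong₂ _+_ (entry-firstRow C k) (L-diagonal k k<n))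
                   (cong₂ _+_ (entry-firstRow C k) (trans L-2k-k (L-column0 0<k k<n)))))
      (cong₂ _*_ (cong₂ _+_ (entry-firstRow C _) (trans L-k-2k (entry-firstRow C k)))
                 (cong₂ _+_ (entry-firstRow C _) (L-diagonal _ 2k<n)))
    -- n ≡ 0 and n - 1 ≡ corners (mod 4), so corners + 1 ≡ 0 (mod 4).
    4∣n-1+1 : + 4 ∣ + (n ∸ 1) + 1ℤ
    4∣n-1+1 = subst (+ 4 ∣_) (trans (cong +_ (sym (ℕP.m∸n+n≡m 0<n))) (ℤP.pos-+ (n ∸ 1) 1)) 4∣n
    4∣corners+1 : + 4 ∣ cornerSum (c k) (c (n ∸ k)) (c (2 ℕ.* k)) (c (n ∸ 2 ℕ.* k)) + 1ℤ
    4∣corners+1 = subst (+ 4 ∣_) (trans (difference (+ (n ∸ 1)) (F 0 + F k + F (2 ℕ.* k))) (cong (_+ 1ℤ) corners))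
      (∣m∣n⇒∣m-n 4∣n-1+1
        (threeRows-by4 n L 0<n k<n 2k<n (ℕP.>⇒≢ 0<k) (ℕP.>⇒≢ 0<2k) (ℕP.>⇒≢ k<2k) L-pm L-orthogonal))
      where
      difference : ∀ N S → (N + 1ℤ) - (N - S) ≡ S + 1ℤ
      difference = solve-∀

  seqA-pm : ∀ {v} → 2 ℕ.* v ≡ n → ∀ i → IsPM1 (seqA C v i)
  seqA-pm {v} 2v≡n i = subst IsPM1 (sym (seqA≡evenWithOne C v i)) (pm (toℕ i) (toℕ<n i))
    where
    pm : ∀ j → j < v → IsPM1 (evenWithOne c j)
    pm zero    _   = inj₁ refl
    pm (suc j) j<v = c-pm z<s (subst (2 ℕ.* suc j <_) 2v≡n (ℕP.*-monoʳ-< 2 j<v))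

  seqB-pm : ∀ {v} → 2 ℕ.* v ≡ n → ∀ i → IsPM1 (seqB C v i)
  seqB-pm {v} 2v≡n i = c-pm z<s (subst₂ _≤_ (ℕP.*-suc 2 (toℕ i)) 2v≡n (ℕP.*-monoʳ-≤ 2 (toℕ<n i)))

  autocorr-evenWithOne : ∀ {v} → 2 ℕ.* v ≡ n → ∀ {k} → 0 < k → k < v →
    autocorr v (evenWithOne c) k ≡ autocorr v (evens c) k + (c (2 ℕ.* k) - c (n ∸ 2 ℕ.* k))
  autocorr-evenWithOne {v} 2v≡n {k} 0<k k<v = begin
      autocorr v (evenWithOne c) k
    ≡⟨ autocorr-cong v (λ j _ → bumped j) k<v ⟩
      autocorr v (λ j → evens c j + δ j 0) k
    ≡⟨ autocorr-bumpFirst v (evens c) 0<k k<v ⟩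
      autocorr v (evens c) k + (c (2 ℕ.* k) - c (2 ℕ.* (v ∸ k)))
    ≡⟨ cong (λ m → autocorr v (evens c) k + (c (2 ℕ.* k) - c m))
            (trans (ℕP.*-distribˡ-∸ 2 v k) (cong (_∸ 2 ℕ.* k) 2v≡n)) ⟩
      autocorr v (evens c) k + (c (2 ℕ.* k) - c (n ∸ 2 ℕ.* k)) ∎
    where
    0<n : 0 < n
    0<n = subst (0 <_) 2v≡n (ℕP.*-monoʳ-< 2 (ℕP.m<n⇒0<n k<v))
    bumped : ∀ j → evenWithOne c j ≡ evens c j + δ j 0
    bumped zero    = sym (cong (_+ 1ℤ) (c-zero 0<n))
    bumped (suc j) = sym (ℤP.+-identityʳ _)

proposition8 : (n : ℕ) (C : Matrix n) →
    n % 4 ≡ 0 →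
    IsConference C → IsNegacyclic C →
    IsNegaperiodicGolayPair (seqA C (n / 2)) (seqB C (n / 2))
proposition8 n C n%4≡0 conf neg = seqA-pm 2v≡n , seqB-pm 2v≡n , golay
  where
  open NegacyclicConference C conf neg
  v : ℕ
  v = n / 2
  4∣n : 4 ℕD.∣ n
  4∣n = ℕD.m%n≡0⇒n∣m n 4 n%4≡0
  2v≡n : 2 ℕ.* v ≡ n
  2v≡n = m*[n/m]≡n (ℕD.∣-trans (ℕD.divides 2 refl) 4∣n)
  golay : ∀ k → 0 < k → k < v → NAF (seqA C v) k + NAF (seqB C v) k ≡ 0ℤ
  golay k 0<k k<v = begin
      NAF (seqA C v) k + NAF (seqB C v) k
    ≡⟨ cong₂ _+_ (NAF≡autocorr _ (evenWithOne c) (seqA≡evenWithOne C v) k<v)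
                 (NAF≡autocorr _ (odds c) (λ _ → refl) k<v) ⟩
      autocorr v (evenWithOne c) k + autocorr v (odds c) k
    ≡⟨ cong (_+ autocorr v (odds c) k) (autocorr-evenWithOne 2v≡n 0<k k<v) ⟩
      autocorr v (evens c) k + (c (2 ℕ.* k) - c (n ∸ 2 ℕ.* k)) + autocorr v (odds c) k
    ≡⟨ cong (λ d → autocorr v (evens c) k + d + autocorr v (odds c) k)
            (trans (cong (_- c (n ∸ 2 ℕ.* k)) (evenSymmetry (∣ᵤ⇒∣ 4∣n) 0<k 2k<n)) (ℤP.+-inverseʳ (c (n ∸ 2 ℕ.* k)))) ⟩
      autocorr v (evens c) k + 0ℤ + autocorr v (odds c) k
    ≡⟨ cong (_+ autocorr v (odds c) k) (ℤP.+-identityʳ (autocorr v (evens c) k)) ⟩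
      autocorr v (evens c) k + autocorr v (odds c) k
    ≡⟨ sym (autocorr-evenOdd v c k<v) ⟩
      autocorr (2 ℕ.* v) c (2 ℕ.* k)
    ≡⟨ cong (λ N → autocorr N c (2 ℕ.* k)) 2v≡n ⟩
      autocorr n c (2 ℕ.* k)
    ≡⟨ autocorr-c (ℕP.*-monoʳ-< 2 0<k) 2k<n ⟩
      0ℤ ∎
    where
    2k<n : 2 ℕ.* k < n
    2k<n = subst (2 ℕ.* k <_) 2v≡n (ℕP.*-monoʳ-< 2 k<v)
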